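{- Let $G$ be a connected graph with minimum degree $\delta(G)=1$ and let $S$ be a multiset of positive integers with $|S|=|V(G)|$. If $G$ is $S$-fair, then $G$ is a star (a complete bipartite graph $K_{1,n}$ for some $n\ge 1$).
   Context: For a finite simple undirected graph $G$ and a multiset $S$ of positive integers with $|S|=|V(G)|$, $G$ is called $S$-fair if there is a bijection $f$ from $V(G)$ to $S$ (each occurrence of an element of $S$ is assigned to exactly one vertex) and a constant $k$ such that for every vertex $v\in V(G)$, $\sum_{u\in N_G(v)} f(u)=k$, where $N_G(v)$ is the set of neighbours of $v$. -}

module Defs where

open import Data.Nat using (ℕ; zero; suc; _+_; _≤_; _<_)
open import Data.Bool using (Bool; true; false; if_then_else_)
open import Data.Fin using (Fin)
open import Data.Product using (Σ; ∃; _×_; _,_)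
open import Data.Sum using (_⊎_)
open import Function.Bundles using (_↔_; Inverse)
open import Relation.Binary.PropositionalEquality using (_≡_; _≢_)
open import Relation.Nullary using (¬_)

Σ[<_]_ : (n : ℕ) → (Fin n → ℕ) → ℕ
Σ[< zero ] f = 0
Σ[< suc n ] f = f Fin.zero + (Σ[< n ] (λ i → f (Fin.suc i)))

record Graph (n : ℕ) : Set where
  field
    adj   : Fin n → Fin n → Bool
    sym   : ∀ u v → adj u v ≡ adj v u
    irrefl : ∀ v → adj v v ≡ false
open Graph public

Adj : ∀ {n} → Graph n → Fin n → Fin n → Set
Adj G u v = adj G u v ≡ true

degree : ∀ {n} → Graph n → Fin n → ℕ
degree {n} G v = Σ[< n ] (λ u → if adj G v u then 1 else 0)

MinDegree : ∀ {n} → Graph n → ℕ → Set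
MinDegree {n} G d = (∀ v → d ≤ degree G v) × ∃ λ v → degree G v ≡ d

data Reach {n} (G : Graph n) : Fin n → Fin n → Set where
  here : ∀ {v} → Reach G v v
  step : ∀ {u w v} → Adj G u w → Reach G w v → Reach G u v

Connected : ∀ {n} → Graph n → Set
Connected {n} G = ∀ (u v : Fin n) → Reach G u v

nbrSum : ∀ {n} → Graph n → (Fin n → ℕ) → Fin n → ℕ
nbrSum {n} G f v = Σ[< n ] (λ u → if adj G v u then f u else 0)

-- S is a multiset of size n, represented as a list of n entries S : Fin n → ℕ
-- (each entry is one occurrence).  G is S-fair if there is a bijection
-- σ : V(G) ↔ (occurrence indices of S), f = S ∘ σ, and a constant k with
-- nbrSum f v = k for all v.
SFair : ∀ {n} → Graph n → (Fin n → ℕ) → Set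
SFair {n} G S = Σ (Fin n ↔ Fin n) λ σ → ∃ λ k →
  ∀ v → nbrSum G (λ u → S (Inverse.to σ u)) v ≡ k

IsStar : ∀ {n} → Graph n → Set
IsStar {n} G = 2 ≤ n × ∃ λ (c : Fin n) →
  ∀ u v → u ≢ v → (Adj G u v → (u ≡ c ⊎ v ≡ c)) × ((u ≡ c ⊎ v ≡ c) → Adj G u v)

module Submission where

-- A leaf v has a single neighbour u, so the constant neighbour sum k equals the
-- label of u.  Any neighbour x of u already collects k from u alone; since all
-- labels are positive, x can have no other neighbour.  By connectivity every
-- vertex is then u or one of these pendant neighbours of u: G is a star centred
-- at u.

open import Defs hiding (sym)
open import Data.Nat using (ℕ; zero; suc; _+_; _≤_; _<_; z≤n; s≤s)
open import Data.Nat.Properties using (≤-trans; m≤m+n; m≤n+m; +-monoʳ-≤; +-comm; +-identityʳ; +-cancelʳ-≤; <⇒≱)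
open import Data.Fin using (Fin; _≟_)
open import Data.Fin.Properties using (suc-injective; any?)
open import Data.Bool using (Bool; true; false; if_then_else_)
open import Data.Bool.Properties using (¬-not)
open import Data.Product using (∃; _,_)
open import Data.Sum using (_⊎_; inj₁; inj₂)
open import Function.Bundles using (Inverse)
open import Relation.Binary.PropositionalEquality
open import Relation.Nullary using (¬_; yes; no; contradiction)

term≤Σ : ∀ {n} (g : Fin n → ℕ) y → g y ≤ Σ[< n ] g
term≤Σ g Fin.zero    = m≤m+n _ _
term≤Σ g (Fin.suc y) = ≤-trans (term≤Σ (λ i → g (Fin.suc i)) y) (m≤n+m _ _)

two-terms≤Σ : ∀ {n} (g : Fin n → ℕ) {y z} → y ≢ z → g y + g z ≤ Σ[< n ] g
two-terms≤Σ g {Fin.zero}  {Fin.zero}  y≢z = contradiction refl y≢z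
two-terms≤Σ g {Fin.zero}  {Fin.suc z} _   = +-monoʳ-≤ (g Fin.zero) (term≤Σ (λ i → g (Fin.suc i)) z)
two-terms≤Σ g {Fin.suc y} {Fin.zero}  _   =
  subst (_≤ Σ[< _ ] g) (+-comm (g Fin.zero) (g (Fin.suc y)))
        (+-monoʳ-≤ (g Fin.zero) (term≤Σ (λ i → g (Fin.suc i)) y))
two-terms≤Σ g {Fin.suc y} {Fin.suc z} y≢z =
  ≤-trans (two-terms≤Σ (λ i → g (Fin.suc i)) (λ y≡z → y≢z (cong Fin.suc y≡z))) (m≤n+m _ _)

Σ-zero : ∀ {n} (g : Fin n → ℕ) → (∀ y → g y ≡ 0) → Σ[< n ] g ≡ 0
Σ-zero {zero}  g g≡0 = refl
Σ-zero {suc n} g g≡0 rewrite g≡0 Fin.zero = Σ-zero (λ i → g (Fin.suc i)) (λ y → g≡0 (Fin.suc y))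

Σ-single : ∀ {n} (g : Fin n → ℕ) u → (∀ x → x ≢ u → g x ≡ 0) → Σ[< n ] g ≡ g u
Σ-single g Fin.zero g≡0
  rewrite Σ-zero (λ i → g (Fin.suc i)) (λ y → g≡0 (Fin.suc y) (λ ())) = +-identityʳ _
Σ-single g (Fin.suc u) g≡0 rewrite g≡0 Fin.zero (λ ()) =
  Σ-single (λ i → g (Fin.suc i)) u (λ x x≢u → g≡0 (Fin.suc x) (λ e → x≢u (suc-injective e)))

≢⇒2≤size : ∀ {n} {a b : Fin n} → a ≢ b → 2 ≤ n
≢⇒2≤size {suc zero}    {Fin.zero} {Fin.zero} a≢b = contradiction refl a≢b
≢⇒2≤size {suc (suc n)} _ = s≤s (s≤s z≤n)

if-true : ∀ {b : Bool} (x : ℕ) → b ≡ true → (if b then x else 0) ≡ x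
if-true x refl = refl

if-false : ∀ {b : Bool} (x : ℕ) → b ≡ false → (if b then x else 0) ≡ 0
if-false x refl = refl

module _ {n} (G : Graph n) where

  Adj⇒≢ : ∀ {u v} → Adj G u v → u ≢ v
  Adj⇒≢ {u} u~v refl with () ← trans (sym (Graph.irrefl G u)) u~v

  Adj-sym : ∀ {u v} → Adj G u v → Adj G v u
  Adj-sym {u} {v} u~v = trans (Graph.sym G v u) u~v

  nbrSum-no-neighbour : ∀ f {v} → (∀ w → ¬ Adj G v w) → nbrSum G f v ≡ 0
  nbrSum-no-neighbour f {v} isolated =
    Σ-zero _ (λ w → if-false (f w) (¬-not (isolated w)))

  nbrSum-one-neighbour : ∀ f {v u} → Adj G v u → (∀ w → Adj G v w → w ≡ u) → nbrSum G f v ≡ f u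
  nbrSum-one-neighbour f {v} {u} v~u unique =
    trans (Σ-single _ u (λ w w≢u → if-false (f w) (¬-not (λ v~w → w≢u (unique w v~w)))))
          (if-true (f u) v~u)

  two-neighbours≤nbrSum : ∀ f {v y z} → Adj G v y → Adj G v z → y ≢ z → f y + f z ≤ nbrSum G f v
  two-neighbours≤nbrSum f {v} v~y v~z y≢z =
    subst (_≤ nbrSum G f v) (cong₂ _+_ (if-true _ v~y) (if-true _ v~z))
          (two-terms≤Σ (λ w → if adj G v w then f w else 0) y≢z)

  degree-one⇒neighbour : ∀ {v} → degree G v ≡ 1 → ∃ (Adj G v)
  degree-one⇒neighbour {v} deg≡1 with any? (λ u → Data.Bool._≟_ (adj G v u) true)
  ... | yes v~u  = v~u
  ... | no ¬v~u with () ← trans (sym deg≡1) (nbrSum-no-neighbour (λ _ → 1) (λ u v~u → ¬v~u (u , v~u)))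

  degree-one⇒unique-neighbour : ∀ {v u} → degree G v ≡ 1 → Adj G v u → ∀ w → Adj G v w → w ≡ u
  degree-one⇒unique-neighbour {v} {u} deg≡1 v~u w v~w with w ≟ u
  ... | yes w≡u = w≡u
  ... | no  w≢u with s≤s () ← subst (2 ≤_) deg≡1 (two-neighbours≤nbrSum (λ _ → 1) v~w v~u w≢u)

  label≡nbrSum⇒neighbours-pendant : ∀ f {k u} → (∀ x → 0 < f x) → (∀ x → nbrSum G f x ≡ k) →
    f u ≡ k → ∀ {x y} → Adj G u x → Adj G x y → y ≡ u
  label≡nbrSum⇒neighbours-pendant f {k} {u} f>0 nbrSum≡k fu≡k {x} {y} u~x x~y with y ≟ u
  ... | yes y≡u = y≡u
  ... | no  y≢u = contradiction fy≤0 (<⇒≱ (f>0 y))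
    where
    fy≤0 : f y ≤ 0
    fy≤0 = +-cancelʳ-≤ (f u) (f y) 0
      (subst (f y + f u ≤_) (trans (nbrSum≡k x) (sym fu≡k)) (two-neighbours≤nbrSum f x~y (Adj-sym u~x) y≢u))

  module _ (c : Fin n) (pendant : ∀ {x y} → Adj G c x → Adj G x y → y ≡ c) where

    centre-or-spoke : Connected G → ∀ w → w ≡ c ⊎ Adj G c w
    centre-or-spoke conn w = go (conn c w) (inj₁ refl)
      where
      go : ∀ {a b} → Reach G a b → a ≡ c ⊎ Adj G c a → b ≡ c ⊎ Adj G c b
      go here                 p          = p
      go (step a~a′ a′⇝b) (inj₁ refl) = go a′⇝b (inj₂ a~a′)
      go (step a~a′ a′⇝b) (inj₂ c~a)  = go a′⇝b (inj₁ (pendant c~a a~a′))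

    star-centred-at : 2 ≤ n → Connected G → IsStar G
    star-centred-at 2≤n conn = 2≤n , c , λ a b a≢b → edge⇒touches-c a b , touches-c⇒edge a b a≢b
      where
      edge⇒touches-c : ∀ a b → Adj G a b → a ≡ c ⊎ b ≡ c
      edge⇒touches-c a b a~b with centre-or-spoke conn a
      ... | inj₁ a≡c = inj₁ a≡c
      ... | inj₂ c~a = inj₂ (pendant c~a a~b)

      touches-c⇒edge : ∀ a b → a ≢ b → a ≡ c ⊎ b ≡ c → Adj G a b
      touches-c⇒edge a b a≢b (inj₁ refl) with centre-or-spoke conn b
      ... | inj₁ b≡c = contradiction (sym b≡c) a≢b
      ... | inj₂ c~b = c~b
      touches-c⇒edge a b a≢b (inj₂ refl) with centre-or-spoke conn a
      ... | inj₁ a≡c = contradiction a≡c a≢b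
      ... | inj₂ c~a = Adj-sym c~a

lemma2 : ∀ {n} (G : Graph n) (S : Fin n → ℕ) →
    Connected G → MinDegree G 1 → (∀ i → 0 < S i) → SFair G S → IsStar G
lemma2 G S conn (_ , v , deg≡1) S>0 (σ , k , nbrSum≡k) with degree-one⇒neighbour G deg≡1
... | u , v~u = star-centred-at G u pendant (≢⇒2≤size (Adj⇒≢ G v~u)) conn
  where
  f : Fin _ → ℕ
  f x = S (Inverse.to σ x)

  fu≡k : f u ≡ k
  fu≡k = trans (sym (nbrSum-one-neighbour G f v~u (degree-one⇒unique-neighbour G deg≡1 v~u))) (nbrSum≡k v)

  pendant : ∀ {x y} → Adj G u x → Adj G x y → y ≡ u
  pendant = label≡nbrSum⇒neighbours-pendant G f (λ x → S>0 _) nbrSum≡k fu≡k
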